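{- (1) For every rooted tree $t$, $\chi^{ -1}P^*\chi(t)=\mathfrak N(t)=B_+(\bullet)\circ t$; i.e. $\chi^{ -1}P^*\chi$ is left multiplication by $B_+(\bullet)$ in $\mathcal H_{GL}$. (2) For every rooted tree $t$, $\chi^{ -1}N^*\chi(t)=\mathfrak P(t)-B_+\frac{\partial}{\partial\bullet}B_-(t)$.
   Context: A rooted tree is a finite partially ordered set (elements called vertices) with a unique greatest element, the root, such that for every vertex $v$ the set of vertices greater than $v$ is a chain; if $v$ covers $w$, $w$ is a child of $v$. We regard it as a directed graph with an edge from each vertex to each of its children; a vertex is terminal if it has no children. Rooted trees are considered up to isomorphism; $|t|$ is the number of vertices, $\bullet$ the one-vertex tree. Write $t\lhd t'$ if $t$ is obtained from $t'$ by deleting one terminal non-root vertex and the edge into it. For $t\lhd t'$, $n(t;t')$ is the number of vertices of $t$ at which attaching a new edge to a new terminal vertex yields $t'$, and $m(t;t')$ is the number of edges of $t'$ whose removal (with their terminal endpoint) leaves $t$. For a vertex $v$ of $t$, $t_v$ is the rooted tree of $v$ and its descendants; if $v$ has children $v_1,\dots,v_k$, $SG(t,v)$ is the group generated by the exchanges of $t_{v_i}$ with $t_{v_j}$ whenever isomorphic; $SG(t)=\prod_vSG(t,v)$. Let $k$ be a field of characteristic $0$, $k\{\mathcal T\}$ the vector space with basis the rooted trees, inner product $(t,t')=|SG(t)|\delta_{t,t'}$, and linear operators $\mathfrak N(t)=\sum_{t\lhd t'}n(t;t')t'$, $\mathfrak P(t)=\sum_{t'\lhd t}m(t';t)t'$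 for $t\ne\bullet$, $\mathfrak P(\bullet)=0$. $\mathcal H_K$ is the polynomial algebra over $k$ generated by the rooted trees, graded by $\deg t=|t|$; $\frac{\partial}{\partial\bullet}$ is partial differentiation with respect to the generator $\bullet$. $B_+:\mathcal H_K\to k\{\mathcal T\}$ is the linear isomorphism sending a monomial $t_1\cdots t_n$ to the tree obtained by adding a new root joined by new edges to the roots of the $t_i$, with $B_+(1)=\bullet$; $B_-$ is its inverse. The inner product on $\mathcal H_K$ is $(u_1,u_2)=(B_+(u_1),B_+(u_2))$. $N$ is the derivation of $\mathcal H_K$ with $N(t)=\mathfrak N(t)$; $P$ is the derivation with $P(t)=\mathfrak P(t)$ for $|t|\ge2$ and $P(\bullet)=1$. $\mathcal H_K$ is a Hopf algebra with coproduct $\Delta(1)=1\otimes1$, $\Delta(t)=t\otimes1+(\mathrm{id}\otimes B_+)\Delta(B_-(t))$, extended multiplicatively; $\mathcal H_K^{gr}$ is its graded dual with pairing $\langle\cdot,\cdot\rangle$ and product dual to $\Delta$; $N^*,P^*$ are the transposes of $N,P$ on $\mathcal H_K^{gr}$. $\mathcal H_{GL}$ is $k\{\mathcal T\}$ with the Grossman–Larson product $\circ$: for $B_-(t)=t_1\cdots t_k$, $t\circ t'$ is the sum of the $|t'|^k$ trees obtained by attaching each $t_i$ by a new edge from some vertex of $t'$ to the root of $t_i$, and $\bullet\circ t'=t'$. $\chi:\mathcal H_{GL}\to\mathcal H_K^{gr}$ is the linear isomorphism defined by $\langle\chi(t),u\rangle=(t,B_+(u))$ for rooted trees $t$ and monomials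 $u$ of $\mathcal H_K$. -}

module Defs where

open import Level using (_⊔_)
open import Data.Nat as ℕ using (ℕ; zero; suc)
open import Data.Bool using (Bool; true; false; if_then_else_; _∧_)
open import Data.List using (List; []; _∷_; _++_; [_]; map; concat; concatMap; length; filter; foldr)
open import Data.List.Properties using (≡-dec)
open import Data.Product using (_×_; _,_; proj₁; proj₂; Σ; ∃)
open import Relation.Nullary using (¬_; Dec; yes; no)
open import Relation.Nullary.Decidable using (⌊_⌋)
open import Relation.Binary.PropositionalEquality using (_≡_)
open import Algebra.Bundles using (CommutativeRing)

-- A (planar) representative: a root with a list of
-- subtrees (the t_{v_i} of its children).  Rooted trees up to
-- isomorphism = representatives up to permuting children at every
-- vertex; we decide this via a canonical code (sorted recursively).

data Tree : Set where
  node : List Tree → Tree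

• : Tree
• = node []

children : Tree → List Tree
children (node cs) = cs

_≤ᶜ_ : List ℕ → List ℕ → Bool
[] ≤ᶜ _ = true
(x ∷ xs) ≤ᶜ [] = false
(x ∷ xs) ≤ᶜ (y ∷ ys) with x ℕ.<ᵇ y | y ℕ.<ᵇ x
... | true  | _     = true
... | false | true  = false
... | false | false = xs ≤ᶜ ys

insertᶜ : List ℕ → List (List ℕ) → List (List ℕ)
insertᶜ x [] = x ∷ []
insertᶜ x (y ∷ ys) = if x ≤ᶜ y then x ∷ y ∷ ys else y ∷ insertᶜ x ys

sortᶜ : List (List ℕ) → List (List ℕ)
sortᶜ = foldr insertᶜ []

-- canonical (isomorphism-invariant) code of a rooted tree:
-- balanced parentheses of the tree with children sorted recursively
mutual
  code : Tree → List ℕ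
  code (node cs) = 0 ∷ concat (sortᶜ (codes cs)) ++ (1 ∷ [])

  codes : List Tree → List (List ℕ)
  codes [] = []
  codes (c ∷ cs) = code c ∷ codes cs

_≅_ : Tree → Tree → Set
t ≅ s = code t ≡ code s

_≅?_ : (t s : Tree) → Dec (t ≅ s)
t ≅? s = ≡-dec ℕ._≟_ (code t) (code s)

isoᵇ : Tree → Tree → Bool
isoᵇ t s = ⌊ t ≅? s ⌋

isDot : Tree → Bool
isDot (node []) = true
isDot (node (_ ∷ _)) = false

mutual
  size : Tree → ℕ
  size (node cs) = suc (sizeL cs)

  sizeL : List Tree → ℕ
  sizeL [] = 0
  sizeL (c ∷ cs) = size c ℕ.+ sizeL cs

mutual
  -- one entry per vertex v of t: the tree obtained by attaching a new
  -- edge from v to a new terminal vertex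
  grafts : Tree → List Tree
  grafts (node cs) = node (• ∷ cs) ∷ map node (graftsL cs)

  graftsL : List Tree → List (List Tree)
  graftsL [] = []
  graftsL (c ∷ cs) = map (_∷ cs) (grafts c) ++ map (c ∷_) (graftsL cs)

mutual
  -- one entry per edge into a terminal (non-root) vertex of t: the tree
  -- obtained by removing that edge and its terminal endpoint
  prunes : Tree → List Tree
  prunes (node cs) = map node (prunesL cs)

  prunesL : List Tree → List (List Tree)
  prunesL [] = []
  prunesL (node [] ∷ cs) = cs ∷ map (node [] ∷_) (prunesL cs)
  prunesL (node (x ∷ xs) ∷ cs) =
    map (_∷ cs) (prunes (node (x ∷ xs))) ++ map (node (x ∷ xs) ∷_) (prunesL cs)

-- symmetry factor |SG(t)| = ∏_v |SG(t,v)|, where |SG(t,v)| = ∏ m! over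
-- the multiplicities m of the isomorphism classes among the t_{v_i}
countIso : Tree → List Tree → ℕ
countIso t [] = 0
countIso t (s ∷ ss) = (if isoᵇ t s then 1 else 0) ℕ.+ countIso t ss

-- ∏ over isomorphism classes of (multiplicity)!
multFact : List Tree → ℕ
multFact [] = 1
multFact (c ∷ cs) = suc (countIso c cs) ℕ.* multFact cs

mutual
  symm : Tree → ℕ
  symm (node cs) = multFact cs ℕ.* symmL cs

  symmL : List Tree → ℕ
  symmL [] = 1
  symmL (c ∷ cs) = symm c ℕ.* symmL cs

-- Grossman–Larson grafting: attach the trees of a list A = [(i , s)]
-- at the vertices with preorder index i of the (original) tree
here : List (ℕ × Tree) → ℕ → List Tree
here [] n = []
here ((i , s) ∷ A) n = if i ℕ.≡ᵇ n then s ∷ here A n else here A n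

mutual
  att : List (ℕ × Tree) → ℕ → Tree → Tree × ℕ
  att A n (node cs) with attL A (suc n) cs
  ... | cs' , m = node (here A n ++ cs') , m

  attL : List (ℕ × Tree) → ℕ → List Tree → List Tree × ℕ
  attL A n [] = [] , n
  attL A n (c ∷ cs) with att A n c
  ... | c' , m with attL A m cs
  ...   | cs' , m' = c' ∷ cs' , m'

choices : ℕ → List Tree → List (List (ℕ × Tree))
choices N [] = [] ∷ []
choices N (s ∷ F) =
  concatMap (λ i → map ((i , s) ∷_) (choices N F)) (Data.List.upTo N)

-- t ∘ t' as the list of its |t'|^k summand trees
GL : Tree → Tree → List Tree
GL t t' = map (λ A → proj₁ (att A 0 t')) (choices (size t') (children t))

module _ {c ℓ} (R : CommutativeRing c ℓ) where
  open CommutativeRing R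

  IsField : Set (c ⊔ ℓ)
  IsField = (¬ (1# ≈ 0#)) × (∀ x → ¬ (x ≈ 0#) → ∃ λ y → x * y ≈ 1#)

  fromℕ : ℕ → Carrier
  fromℕ zero = 0#
  fromℕ (suc n) = 1# + fromℕ n

  CharZero : Set ℓ
  CharZero = ∀ n → fromℕ n ≈ 0# → n ≡ 0

  sumR : List Carrier → Carrier
  sumR = foldr _+_ 0#

  -- k{T}: finite formal linear combinations of rooted trees
  Vect : Set c
  Vect = List (Carrier × Tree)

  coeff : Vect → Tree → Carrier
  coeff v s = sumR (map (λ p → if isoᵇ (proj₂ p) s then proj₁ p else 0#) v)

  _≈V_ : Vect → Vect → Set ℓ
  v ≈V w = ∀ s → coeff v s ≈ coeff w s

  _−V_ : Vect → Vect → Vect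
  v −V w = v ++ map (λ p → (- proj₁ p , proj₂ p)) w

  basis : Tree → Vect
  basis t = (1# , t) ∷ []

  -- 𝔑(t) = Σ_{t ◁ t'} n(t;t') t' , written as a sum over vertices of t
  𝔑 : Tree → Vect
  𝔑 t = map (λ s → (1# , s)) (grafts t)

  -- 𝔓(t) = Σ_{t' ◁ t} m(t';t) t' (t ≠ •), 𝔓(•) = 0
  𝔓 : Tree → Vect
  𝔓 (node []) = []
  𝔓 (node (x ∷ xs)) = map (λ s → (1# , s)) (prunes (node (x ∷ xs)))

  _∘GL_ : Vect → Vect → Vect
  v ∘GL w = concatMap (λ p → concatMap (λ q →
              map (λ s → (proj₁ p * proj₁ q , s)) (GL (proj₂ p) (proj₂ q))) w) v

  ip : Tree → Tree → Carrier
  ip t s = if isoᵇ t s then fromℕ (symm t) else 0#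

  -- H_K: monomials are lists (multisets) of trees, polynomials are
  -- finite linear combinations of monomials
  Mon : Set
  Mon = List Tree

  Poly : Set c
  Poly = List (Carrier × Mon)

  B₊ : Poly → Vect
  B₊ p = map (λ q → (proj₁ q , node (proj₂ q))) p

  B₋ : Tree → Mon
  B₋ = children

  derivMon : (Tree → Poly) → Mon → Poly
  derivMon D [] = []
  derivMon D (t ∷ u) =
    map (λ q → (proj₁ q , proj₂ q ++ u)) (D t) ++
    map (λ q → (proj₁ q , t ∷ proj₂ q)) (derivMon D u)

  derivPoly : (Tree → Poly) → Poly → Poly
  derivPoly D p = concatMap (λ q → map (λ r → (proj₁ q * proj₁ r , proj₂ r)) (derivMon D (proj₂ q))) p

  vecToPoly : Vect → Poly
  vecToPoly v = map (λ q → (proj₁ q , proj₂ q ∷ [])) v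

  Pgen : Tree → Poly
  Pgen (node []) = (1# , []) ∷ []
  Pgen (node (x ∷ xs)) = vecToPoly (𝔓 (node (x ∷ xs)))

  Ngen : Tree → Poly
  Ngen t = vecToPoly (𝔑 t)

  P N : Mon → Poly
  P = derivMon Pgen
  N = derivMon Ngen

  ∂gen : Tree → Poly
  ∂gen t = if isDot t then (1# , []) ∷ [] else []

  ∂∂• : Poly → Poly
  ∂∂• = derivPoly ∂gen

  -- H_K^gr: linear functionals on H_K, given by their values on monomials
  Dual : Set c
  Dual = Mon → Carrier

  pair : Dual → Poly → Carrier
  pair f p = sumR (map (λ q → proj₁ q * f (proj₂ q)) p)

  _≈D_ : Dual → Dual → Set ℓ
  f ≈D g = ∀ u → f u ≈ g u

  P* N* : Dual → Dual
  P* f u = pair f (P u)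
  N* f u = pair f (N u)

  χ : Vect → Dual
  χ v u = sumR (map (λ q → proj₁ q * ip (proj₂ q) (node u)) v)

-- Write (t , s) = |SG(t)| δ_{t,s} for the inner product of rooted trees.  Expanding
-- (B₊(x u), B₊(v)) along the child x gives a sum, over the entries y of v, of
-- (x , y)(B₊(u), B₊(v without y)): matching x with each tree of v isomorphic to it
-- produces exactly the factor (1 + multiplicity of x in u) of the symmetry factor.
-- With this recursion, induction on trees shows that 𝔓 and 𝔑 are adjoint:
-- Σ_{s ◁ T} (t , s) = Σ_{t ◁ s} (s , T).  Through χ, the operator P* pairs with
-- prunings, which gives (1) at once; N* pairs with the graftings inside the children
-- only, and the missing graft at the root contributes (B₊(• u), T), which is the pairing
-- with B₊ ∂/∂• B₋(T).  Finally B₊(•) ∘ t attaches one leaf at each vertex of t, as 𝔑(t) does.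

module Submission where

open import Defs
open import Data.Product using (_×_; _,_)
open import Data.List using (List; []; _∷_)
open import Algebra.Bundles using (CommutativeRing)

open import Level using (0ℓ)
open import Data.Bool using (true; false; T; if_then_else_)
open import Data.List using ([_]; _++_; concat; concatMap; map; upTo; applyUpTo)
open import Data.List.Membership.Propositional using (_∈_)
open import Data.List.Membership.Propositional.Properties using (∈-map⁻)
open import Data.List.Properties
  using (≡-dec; ++-assoc; ++-identityʳ; ++-cancelʳ; ++-conicalˡ; ∷-injective; ∷-injectiveʳ;
         map-cong; map-++; map-∘; map-applyUpTo; concatMap-map; concatMap-pure)
open import Data.List.Relation.Binary.Permutation.Propositional as ↭
  using (_↭_; ↭-refl; ↭-reflexive; ↭-sym; ↭-trans; ↭⇒↭ₛ; module PermutationReasoning)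
open import Data.List.Relation.Binary.Permutation.Propositional.Properties
  using (All-resp-↭; map⁺; ↭-map-inv; drop-∷; ↭-empty-inv; ∈-resp-↭)
open import Data.List.Relation.Binary.Pointwise using (Pointwise-≡⇒≡)
open import Data.List.Relation.Unary.All using (All; []; _∷_; lookup)
open import Data.List.Relation.Unary.Any as Any using (there)
open import Data.List.Relation.Unary.Sorted.TotalOrder.Properties using (↗↭↗⇒≋)
import Data.List.Sort.InsertionSort.Base as InsertionSort
import Data.List.Sort.InsertionSort.Properties as InsertionSortₚ
open import Data.Nat as ℕ using (ℕ; zero; suc; s≤s; _+_; _*_; _<_; _≤_; _<ᵇ_)
open import Data.Nat.ListAction using (sum)
open import Data.Nat.ListAction.Properties using (sum-↭; sum-++)
import Data.Nat.Properties as ℕₚ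
open import Algebra.Properties.CommutativeSemigroup ℕₚ.+-commutativeSemigroup using (interchange)
open ℕₚ
  using (<-cmp; <-trans; <-irrefl; <⇒≤; ≤-refl; ≤-trans; <-≤-trans; m≤m+n; m<n⇒m<1+n; m+1+n≰m;
         +-monoʳ-≤; +-comm; +-assoc; +-suc; +-identityʳ; *-assoc; *-zeroʳ; *-identityˡ; *-distribʳ-+;
         ≡ᵇ⇒≡; ≡⇒≡ᵇ)
open import Data.Nat.Tactic.RingSolver using (solve-∀)
open import Data.Product using (proj₁; proj₂; map₁; map₂; uncurry)
open import Data.Sum using (_⊎_; inj₁; inj₂)
open import Function using (_∘_; id)
open import Relation.Binary using (_Preserves_⟶_; IsDecTotalOrder; DecTotalOrder; Total; tri<; tri≈; tri>)
open import Relation.Binary.PropositionalEquality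
  using (_≡_; _≢_; refl; sym; trans; cong; cong₂; subst; subst₂; isEquivalence; module ≡-Reasoning)
open import Relation.Nullary using (¬_; Dec; yes; no; T?; contradiction)
open import Relation.Nullary.Decidable using (⌊_⌋; map′)

private variable A B : Set

∑ : List A → (A → ℕ) → ℕ
∑ L f = sum (map f L)

∑-cong : ∀ (L : List A) {f g : A → ℕ} → (∀ x → f x ≡ g x) → ∑ L f ≡ ∑ L g
∑-cong L p = cong sum (map-cong p L)

∑-cong-∈ : ∀ (L : List A) {f g : A → ℕ} → (∀ {x} → x ∈ L → f x ≡ g x) → ∑ L f ≡ ∑ L g
∑-cong-∈ []      p = refl
∑-cong-∈ (x ∷ L) p = cong₂ _+_ (p (Any.here refl)) (∑-cong-∈ L (p ∘ there))

∑-++ : ∀ (L M : List A) (f : A → ℕ) → ∑ (L ++ M) f ≡ ∑ L f + ∑ M f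
∑-++ L M f = trans (cong sum (map-++ f L M)) (sum-++ (map f L) (map f M))

∑-map : ∀ (g : A → B) (L : List A) (f : B → ℕ) → ∑ (map g L) f ≡ ∑ L (f ∘ g)
∑-map g L f = cong sum (sym (map-∘ L))

∑-0 : ∀ (L : List A) → ∑ L (λ _ → 0) ≡ 0
∑-0 []      = refl
∑-0 (x ∷ L) = ∑-0 L

∑-zero : ∀ (L : List A) {f : A → ℕ} → (∀ x → f x ≡ 0) → ∑ L f ≡ 0
∑-zero L p = trans (∑-cong L p) (∑-0 L)

∑-+ : ∀ (L : List A) (f g : A → ℕ) → ∑ L (λ x → f x + g x) ≡ ∑ L f + ∑ L g
∑-+ []      f g = refl
∑-+ (x ∷ L) f g = trans (cong (f x + g x +_) (∑-+ L f g)) (interchange (f x) (g x) (∑ L f) (∑ L g))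

∑-*ʳ : ∀ (L : List A) (f : A → ℕ) c → ∑ L (λ x → f x * c) ≡ ∑ L f * c
∑-*ʳ []      f c = refl
∑-*ʳ (x ∷ L) f c = trans (cong (f x * c +_) (∑-*ʳ L f c)) (sym (*-distribʳ-+ c (f x) (∑ L f)))

∑-comm : ∀ (L : List A) (M : List B) (F : A → B → ℕ) → ∑ L (λ a → ∑ M (F a)) ≡ ∑ M (λ b → ∑ L (λ a → F a b))
∑-comm []      M F = sym (∑-0 M)
∑-comm (x ∷ L) M F = trans (cong (∑ M (F x) +_) (∑-comm L M F)) (sym (∑-+ M (F x) (λ b → ∑ L (λ a → F a b))))

picks : List A → List (A × List A)
picks []       = []
picks (x ∷ xs) = (x , xs) ∷ map (map₂ (x ∷_)) (picks xs)

∑picks : List A → (A → List A → ℕ) → ℕ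
∑picks L f = ∑ (picks L) (uncurry f)

∈-picks⇒↭ : ∀ {L : List A} {p} → p ∈ picks L → proj₁ p ∷ proj₂ p ↭ L
∈-picks⇒↭ {L = x ∷ xs} (Any.here refl) = ↭-refl
∈-picks⇒↭ {L = x ∷ xs} (there m) with (y , R) , m′ , refl ← ∈-map⁻ (map₂ (x ∷_)) m
  = ↭-trans (↭.swap y x ↭-refl) (↭.prep x (∈-picks⇒↭ m′))

∑picks-∷ : ∀ (x : A) xs (f : A → List A → ℕ) → ∑picks (x ∷ xs) f ≡ f x xs + ∑picks xs (λ y R → f y (x ∷ R))
∑picks-∷ x xs f = cong (f x xs +_) (∑-map (map₂ (x ∷_)) (picks xs) (uncurry f))

∑picks-cong : ∀ (L : List A) {f g : A → List A → ℕ} → (∀ {y R} → y ∷ R ↭ L → f y R ≡ g y R) → ∑picks L f ≡ ∑picks L g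
∑picks-cong L p = ∑-cong-∈ (picks L) (p ∘ ∈-picks⇒↭)

∑picks-fst : ∀ (L : List A) (f : A → ℕ) → ∑picks L (λ y _ → f y) ≡ ∑ L f
∑picks-fst []       f = refl
∑picks-fst (x ∷ xs) f = trans (∑picks-∷ x xs (λ y _ → f y)) (cong (f x +_) (∑picks-fst xs f))

_≟ᶜ_ : (c c′ : List ℕ) → Dec (c ≡ c′)
_≟ᶜ_ = ≡-dec ℕ._≟_

-- A record rather than T (xs ≤ᶜ ys), so that xs and ys can be inferred from the type.
record _≼_ (xs ys : List ℕ) : Set where
  constructor ≼-intro
  field ≼-elim : T (xs ≤ᶜ ys)

open _≼_

<⇒<ᵇ≡true : ∀ {x y} → x < y → (x <ᵇ y) ≡ true
<⇒<ᵇ≡true {zero}  {suc y} _         = refl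
<⇒<ᵇ≡true {suc x} {suc y} (s≤s p) = <⇒<ᵇ≡true p

≥⇒<ᵇ≡false : ∀ {x y} → y ≤ x → (x <ᵇ y) ≡ false
≥⇒<ᵇ≡false {x}     {zero}  _         = refl
≥⇒<ᵇ≡false {suc x} {suc y} (s≤s p) = ≥⇒<ᵇ≡false p

module _ {x y : ℕ} {xs ys : List ℕ} where

  ∷≤ᶜ∷-< : x < y → ((x ∷ xs) ≤ᶜ (y ∷ ys)) ≡ true
  ∷≤ᶜ∷-< p rewrite <⇒<ᵇ≡true p = refl

  ∷≤ᶜ∷-> : y < x → ((x ∷ xs) ≤ᶜ (y ∷ ys)) ≡ false
  ∷≤ᶜ∷-> p rewrite ≥⇒<ᵇ≡false (<⇒≤ p) | <⇒<ᵇ≡true p = refl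

  ∷≼∷-< : x < y → (x ∷ xs) ≼ (y ∷ ys)
  ∷≼∷-< p = ≼-intro (subst T (sym (∷≤ᶜ∷-< p)) _)

  ∷⋠∷-> : y < x → ¬ (x ∷ xs) ≼ (y ∷ ys)
  ∷⋠∷-> p (≼-intro q) = subst T (∷≤ᶜ∷-> p) q

∷≤ᶜ∷ : ∀ x xs ys → ((x ∷ xs) ≤ᶜ (x ∷ ys)) ≡ (xs ≤ᶜ ys)
∷≤ᶜ∷ x xs ys rewrite ≥⇒<ᵇ≡false (≤-refl {x}) = refl

≼-∷⁻ : ∀ {x xs ys} → (x ∷ xs) ≼ (x ∷ ys) → xs ≼ ys
≼-∷⁻ {x} {xs} {ys} (≼-intro p) = ≼-intro (subst T (∷≤ᶜ∷ x xs ys) p)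

≼-∷⁺ : ∀ {x xs ys} → xs ≼ ys → (x ∷ xs) ≼ (x ∷ ys)
≼-∷⁺ {x} {xs} {ys} (≼-intro p) = ≼-intro (subst T (sym (∷≤ᶜ∷ x xs ys)) p)

≼-refl : ∀ xs → xs ≼ xs
≼-refl []       = ≼-intro _
≼-refl (x ∷ xs) = ≼-∷⁺ (≼-refl xs)

≼-antisym : ∀ {xs ys} → xs ≼ ys → ys ≼ xs → xs ≡ ys
≼-antisym {[]}     {[]}     _ _ = refl
≼-antisym {x ∷ xs} {y ∷ ys} p q with <-cmp x y
... | tri< x<y _ _  = contradiction q (∷⋠∷-> x<y)
... | tri> _ _ y<x  = contradiction p (∷⋠∷-> y<x)
... | tri≈ _ refl _ = cong (x ∷_) (≼-antisym (≼-∷⁻ p) (≼-∷⁻ q))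

≼-trans : ∀ {xs ys zs} → xs ≼ ys → ys ≼ zs → xs ≼ zs
≼-trans {[]}                         _ _ = ≼-intro _
≼-trans {x ∷ xs} {y ∷ ys} {z ∷ zs} p q with <-cmp x y | <-cmp y z
... | tri> _ _ y<x  | _             = contradiction p (∷⋠∷-> y<x)
... | _             | tri> _ _ z<y  = contradiction q (∷⋠∷-> z<y)
... | tri< x<y _ _  | tri< y<z _ _  = ∷≼∷-< (<-trans x<y y<z)
... | tri< x<y _ _  | tri≈ _ refl _ = ∷≼∷-< x<y
... | tri≈ _ refl _ | tri< y<z _ _  = ∷≼∷-< y<z
... | tri≈ _ refl _ | tri≈ _ refl _ = ≼-∷⁺ (≼-trans (≼-∷⁻ p) (≼-∷⁻ q))

≼-total : Total _≼_
≼-total []       _        = inj₁ (≼-intro _)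
≼-total (x ∷ xs) []       = inj₂ (≼-intro _)
≼-total (x ∷ xs) (y ∷ ys) with <-cmp x y
... | tri< x<y _ _  = inj₁ (∷≼∷-< x<y)
... | tri> _ _ y<x  = inj₂ (∷≼∷-< y<x)
... | tri≈ _ refl _ with ≼-total xs ys
...   | inj₁ p = inj₁ (≼-∷⁺ p)
...   | inj₂ q = inj₂ (≼-∷⁺ q)

≼-isDecTotalOrder : IsDecTotalOrder _≡_ _≼_
≼-isDecTotalOrder = record
  { isTotalOrder = record
    { isPartialOrder = record
      { isPreorder = record
        { isEquivalence = isEquivalence
        ; reflexive     = λ { refl → ≼-refl _ }
        ; trans         = ≼-trans
        }
      ; antisym = ≼-antisym
      }
    ; total = ≼-total
    }
  ; _≟_  = _≟ᶜ_
  ; _≤?_ = λ xs ys → map′ ≼-intro ≼-elim (T? (xs ≤ᶜ ys))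
  }

≼-decTotalOrder : DecTotalOrder 0ℓ 0ℓ 0ℓ
≼-decTotalOrder = record { isDecTotalOrder = ≼-isDecTotalOrder }

open InsertionSort ≼-decTotalOrder using (insert; sort)
open InsertionSortₚ ≼-decTotalOrder using (sort-↭; sort-↗)

insertᶜ≡insert : ∀ c cs → insertᶜ c cs ≡ insert c cs
insertᶜ≡insert c []       = refl
insertᶜ≡insert c (c′ ∷ cs) with c ≤ᶜ c′
... | true  = refl
... | false = cong (c′ ∷_) (insertᶜ≡insert c cs)

sortᶜ≡sort : ∀ cs → sortᶜ cs ≡ sort cs
sortᶜ≡sort []       = refl
sortᶜ≡sort (c ∷ cs) = trans (cong (insertᶜ c) (sortᶜ≡sort cs)) (insertᶜ≡insert c (sort cs))

sortᶜ-↭ : ∀ cs → sortᶜ cs ↭ cs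
sortᶜ-↭ cs = subst (_↭ cs) (sym (sortᶜ≡sort cs)) (sort-↭ cs)

sortᶜ-cong : ∀ {cs ds} → cs ↭ ds → sortᶜ cs ≡ sortᶜ ds
sortᶜ-cong {cs} {ds} p = begin
  sortᶜ cs ≡⟨ sortᶜ≡sort cs ⟩
  sort cs  ≡⟨ Pointwise-≡⇒≡ (↗↭↗⇒≋ totalOrder (sort-↗ cs) (sort-↗ ds) (↭⇒↭ₛ sort-cs↭sort-ds)) ⟩
  sort ds  ≡⟨ sortᶜ≡sort ds ⟨
  sortᶜ ds ∎
  where
    open ≡-Reasoning
    open DecTotalOrder ≼-decTotalOrder using (totalOrder)
    sort-cs↭sort-ds : sort cs ↭ sort ds
    sort-cs↭sort-ds = ↭-trans (sort-↭ cs) (↭-trans p (↭-sym (sort-↭ ds)))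

-- With 0 as an opening and any other entry as a closing bracket, closing n w cuts w
-- just after its (n + 1)-th unmatched closing bracket.
closing : ℕ → List ℕ → List ℕ × List ℕ
closing n       []           = [] , []
closing n       (zero ∷ w)   = map₁ (0 ∷_) (closing (suc n) w)
closing zero    (suc k ∷ w)  = suc k ∷ [] , w
closing (suc n) (suc k ∷ w)  = map₁ (suc k ∷_) (closing n w)

firstBlock : List ℕ → List ℕ × List ℕ
firstBlock (zero ∷ w) = map₁ (0 ∷_) (closing 0 w)
firstBlock _          = [] , []

Balanced : List ℕ → Set
Balanced w = ∀ n r → closing n (w ++ r) ≡ map₁ (w ++_) (closing n r)

IsBlock : List ℕ → Set
IsBlock w = ∀ r → firstBlock (w ++ r) ≡ (w , r)

Balanced-++ : ∀ {u v} → Balanced u → Balanced v → Balanced (u ++ v)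
Balanced-++ {u} {v} bu bv n r
  rewrite ++-assoc u v r | bu n (v ++ r) | bv n r | ++-assoc u v (proj₁ (closing n r)) = refl

Balanced-concat : ∀ {ws} → All Balanced ws → Balanced (concat ws)
Balanced-concat []         n r = refl
Balanced-concat (bw ∷ bws) = Balanced-++ bw (Balanced-concat bws)

codes≡map : ∀ cs → codes cs ≡ map code cs
codes≡map []       = refl
codes≡map (c ∷ cs) = cong (code c ∷_) (codes≡map cs)

mutual
  inner-balanced : ∀ cs → Balanced (concat (sortᶜ (codes cs)))
  inner-balanced cs = Balanced-concat (All-resp-↭ (↭-sym (sortᶜ-↭ (codes cs))) (codes-balanced cs))

  codes-balanced : ∀ cs → All Balanced (codes cs)
  codes-balanced []       = []
  codes-balanced (c ∷ cs) = code-balanced c ∷ codes-balanced cs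

  code-balanced : ∀ t → Balanced (code t)
  code-balanced (node cs) n r
    rewrite ++-assoc (concat (sortᶜ (codes cs))) (1 ∷ []) r
          | inner-balanced cs (suc n) (1 ∷ r)
          | ++-assoc (concat (sortᶜ (codes cs))) (1 ∷ []) (proj₁ (closing n r)) = refl

code-block : ∀ t → IsBlock (code t)
code-block (node cs) r
  rewrite ++-assoc (concat (sortᶜ (codes cs))) (1 ∷ []) r
        | inner-balanced cs 0 (1 ∷ r) = refl

codes-blocks : ∀ cs → All IsBlock (codes cs)
codes-blocks []       = []
codes-blocks (c ∷ cs) = code-block c ∷ codes-blocks cs

block≢[] : ¬ IsBlock []
block≢[] b with b (0 ∷ 1 ∷ [])
... | ()

concat-blocks-injective : ∀ {vs ws} → All IsBlock vs → All IsBlock ws → concat vs ≡ concat ws → vs ≡ ws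
concat-blocks-injective []         []         _ = refl
concat-blocks-injective []         (bw ∷ _)   e = contradiction (subst IsBlock (++-conicalˡ _ _ (sym e)) bw) block≢[]
concat-blocks-injective (bv ∷ _)   []         e = contradiction (subst IsBlock (++-conicalˡ _ _ e) bv) block≢[]
concat-blocks-injective {v ∷ vs} {w ∷ ws} (bv ∷ bvs) (bw ∷ bws) e
  with split ← trans (sym (bv (concat vs))) (trans (cong firstBlock e) (bw (concat ws)))
  = cong₂ _∷_ (cong proj₁ split) (concat-blocks-injective bvs bws (cong proj₂ split))

infix 4 _∼_
_∼_ : List Tree → List Tree → Set
W ∼ V = map code W ↭ map code V

-- The code of node W is built from the sorted codes of W, and codes are prefix-free.
node-≅⇒∼ : ∀ {W V} → node W ≅ node V → W ∼ V
node-≅⇒∼ {W} {V} e = subst₂ _↭_ (codes≡map W) (codes≡map V) (begin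
    codes W                ↭⟨ ↭-sym (sortᶜ-↭ (codes W)) ⟩
    sortᶜ (codes W)        ≡⟨ sorted-codes ⟩
    sortᶜ (codes V)        ↭⟨ sortᶜ-↭ (codes V) ⟩
    codes V                ∎)
  where
    open PermutationReasoning
    blocks : ∀ U → All IsBlock (sortᶜ (codes U))
    blocks U = All-resp-↭ (↭-sym (sortᶜ-↭ (codes U))) (codes-blocks U)
    sorted-codes : sortᶜ (codes W) ≡ sortᶜ (codes V)
    sorted-codes = concat-blocks-injective (blocks W) (blocks V) (++-cancelʳ (1 ∷ []) _ _ (∷-injectiveʳ e))

∼⇒node-≅ : ∀ {W V} → W ∼ V → node W ≅ node V
∼⇒node-≅ {W} {V} p = cong (λ S → 0 ∷ concat S ++ 1 ∷ [])
  (sortᶜ-cong (subst₂ _↭_ (sym (codes≡map W)) (sym (codes≡map V)) p))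

↭⇒∼ : ∀ {W V} → W ↭ V → W ∼ V
↭⇒∼ = map⁺ code

∷-∼⁻ : ∀ {x y W V} → x ≅ y → x ∷ W ∼ y ∷ V → W ∼ V
∷-∼⁻ {x} {y} {W} {V} e p = drop-∷ (subst (λ c → c ∷ map code W ↭ code y ∷ map code V) e p)

∷-∼ : ∀ {x y W V} → x ≅ y → W ∼ V → x ∷ W ∼ y ∷ V
∷-∼ {x} {y} {W} {V} e p = subst (λ c → c ∷ map code W ↭ code y ∷ map code V) (sym e) (↭.prep (code y) p)

δ : List ℕ → List ℕ → ℕ
δ c c′ = if ⌊ c ≟ᶜ c′ ⌋ then 1 else 0

δ-≡ : ∀ {c c′} → c ≡ c′ → δ c c′ ≡ 1
δ-≡ {c} {c′} e with c ≟ᶜ c′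
... | yes _ = refl
... | no ne = contradiction e ne

δ-≢ : ∀ {c c′} → c ≢ c′ → δ c c′ ≡ 0
δ-≢ {c} {c′} ne with c ≟ᶜ c′
... | yes e = contradiction e ne
... | no _  = refl

countIso≡∑-δ : ∀ x W → countIso x W ≡ ∑ (map code W) (δ (code x))
countIso≡∑-δ x []      = refl
countIso≡∑-δ x (s ∷ W) = cong (δ (code x) (code s) +_) (countIso≡∑-δ x W)

countIso-cong : ∀ {x y W V} → x ≅ y → W ∼ V → countIso x W ≡ countIso y V
countIso-cong {x} {y} {W} {V} e p = begin
  countIso x W                 ≡⟨ countIso≡∑-δ x W ⟩
  ∑ (map code W) (δ (code x))  ≡⟨ sum-↭ (map⁺ (δ (code x)) p) ⟩
  ∑ (map code V) (δ (code x))  ≡⟨ cong (λ c → ∑ (map code V) (δ c)) e ⟩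
  ∑ (map code V) (δ (code y))  ≡⟨ countIso≡∑-δ y V ⟨
  countIso y V                 ∎
  where open ≡-Reasoning

symm-node-∷ : ∀ x W → symm (node (x ∷ W)) ≡ suc (countIso x W) * symm x * symm (node W)
symm-node-∷ x W = regroup (countIso x W) (multFact W) (symm x) (symmL W)
  where
    regroup : ∀ k m s r → suc k * m * (s * r) ≡ suc k * s * (m * r)
    regroup = solve-∀

symm-node-∷-cong : ∀ x {W V} → W ∼ V → symm (node W) ≡ symm (node V) → symm (node (x ∷ W)) ≡ symm (node (x ∷ V))
symm-node-∷-cong x {W} {V} p eq = begin
  symm (node (x ∷ W))                          ≡⟨ symm-node-∷ x W ⟩
  suc (countIso x W) * symm x * symm (node W)  ≡⟨ cong₂ (λ k s → suc k * symm x * s) (countIso-cong refl p) eq ⟩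
  suc (countIso x V) * symm x * symm (node V)  ≡⟨ symm-node-∷ x V ⟨
  symm (node (x ∷ V))                          ∎
  where open ≡-Reasoning

symm-node-swap : ∀ a b W → symm (node (a ∷ b ∷ W)) ≡ symm (node (b ∷ a ∷ W))
symm-node-swap a b W = begin
  symm (node (a ∷ b ∷ W))  ≡⟨ expand a b ⟩
  suc (δ (code a) (code b) + countIso a W) * symm a * (suc (countIso b W) * symm b * symm (node W))
    ≡⟨ exchange (code a ≟ᶜ code b) ⟩
  suc (δ (code b) (code a) + countIso b W) * symm b * (suc (countIso a W) * symm a * symm (node W))
    ≡⟨ expand b a ⟨
  symm (node (b ∷ a ∷ W))  ∎
  where
    open ≡-Reasoning
    expand : ∀ x y → symm (node (x ∷ y ∷ W))
           ≡ suc (δ (code x) (code y) + countIso x W) * symm x * (suc (countIso y W) * symm y * symm (node W))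
    expand x y = trans (symm-node-∷ x (y ∷ W)) (cong (suc (countIso x (y ∷ W)) * symm x *_) (symm-node-∷ y W))
    exchange : Dec (code a ≡ code b)
             → suc (δ (code a) (code b) + countIso a W) * symm a * (suc (countIso b W) * symm b * symm (node W))
             ≡ suc (δ (code b) (code a) + countIso b W) * symm b * (suc (countIso a W) * symm a * symm (node W))
    exchange (yes e) rewrite δ-≡ e | δ-≡ (sym e) | countIso-cong {W = W} e ↭-refl =
      same-class (countIso b W) (symm a) (symm b) (symm (node W))
      where same-class : ∀ k s t r → suc (suc k) * s * (suc k * t * r) ≡ suc (suc k) * t * (suc k * s * r)
            same-class = solve-∀
    exchange (no ne) rewrite δ-≢ ne | δ-≢ (ne ∘ sym) =
      other-class (countIso a W) (countIso b W) (symm a) (symm b) (symm (node W))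
      where other-class : ∀ k l s t r → suc k * s * (suc l * t * r) ≡ suc l * t * (suc k * s * r)
            other-class = solve-∀

symm-node-↭ : ∀ {W V} → W ↭ V → symm (node W) ≡ symm (node V)
symm-node-↭ ↭.refl               = refl
symm-node-↭ (↭.prep x p)         = symm-node-∷-cong x (↭⇒∼ p) (symm-node-↭ p)
symm-node-↭ {a ∷ b ∷ W} (↭.swap a b p) = trans (symm-node-swap a b W)
  (symm-node-∷-cong b (↭⇒∼ (↭.prep a p)) (symm-node-∷-cong a (↭⇒∼ p) (symm-node-↭ p)))
symm-node-↭ (↭.trans p q)        = trans (symm-node-↭ p) (symm-node-↭ q)

-- W ∼ V factors as a pointwise isomorphism from W to some W′ followed by a permutation W′ ↭ V.
mutual
  symm-cong : ∀ {t s} → t ≅ s → symm t ≡ symm s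
  symm-cong {node W} {node V} e with W′ , eq , V↭W′ ← ↭-map-inv code (↭-sym (node-≅⇒∼ {W} {V} e))
    = trans (symm-node-pointwise {W} {W′} eq) (sym (symm-node-↭ V↭W′))

  symm-node-pointwise : ∀ {W V} → map code W ≡ map code V → symm (node W) ≡ symm (node V)
  symm-node-pointwise {[]}    {[]}    _  = refl
  symm-node-pointwise {x ∷ W} {y ∷ V} eq with ex , eW ← ∷-injective eq = begin
    symm (node (x ∷ W))                          ≡⟨ symm-node-∷ x W ⟩
    suc (countIso x W) * symm x * symm (node W)
      ≡⟨ cong₂ _*_ (cong₂ (λ k s → suc k * s) (countIso-cong ex (↭-reflexive eW)) (symm-cong ex)) (symm-node-pointwise eW) ⟩
    suc (countIso y V) * symm y * symm (node V)  ≡⟨ symm-node-∷ y V ⟨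
    symm (node (y ∷ V))                          ∎
    where open ≡-Reasoning

-- The inner product (t , s) = |SG(t)| δ_{t,s} with values in ℕ; ip in k is its image (ip≡⟦Ip⟧).
Ip : Tree → Tree → ℕ
Ip t s = if isoᵇ t s then symm t else 0

Ip-cases : ∀ {t s n} → (t ≅ s → symm t ≡ n) → (¬ t ≅ s → 0 ≡ n) → Ip t s ≡ n
Ip-cases {t} {s} iso non-iso with t ≅? s
... | yes e = iso e
... | no ne = non-iso ne

Ip-≅ : ∀ {t s} → t ≅ s → Ip t s ≡ symm t
Ip-≅ e = Ip-cases (λ _ → refl) (λ ne → contradiction e ne)

Ip-≇ : ∀ {t s} → ¬ t ≅ s → Ip t s ≡ 0
Ip-≇ ne = Ip-cases (λ e → contradiction e ne) (λ _ → refl)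

Ip-sym : ∀ t s → Ip t s ≡ Ip s t
Ip-sym t s = Ip-cases (λ e → trans (symm-cong e) (sym (Ip-≅ {s} {t} (sym e)))) (λ ne → sym (Ip-≇ {s} {t} (ne ∘ sym)))

Ip-congʳ : ∀ t {s s′} → s ≅ s′ → Ip t s ≡ Ip t s′
Ip-congʳ t {s} {s′} e =
  Ip-cases (λ e′ → sym (Ip-≅ {t} {s′} (trans e′ e))) (λ ne → sym (Ip-≇ {t} {s′} (ne ∘ λ e′ → trans e′ (sym e))))

Ip-congˡ : ∀ {t t′} s → t ≅ t′ → Ip t s ≡ Ip t′ s
Ip-congˡ {t} {t′} s e = trans (Ip-sym t s) (trans (Ip-congʳ s {t} {t′} e) (Ip-sym s t′))

-- Pairing x with each tree of L counts the copies of x in L, which yields the factor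
-- suc (countIso x W) of symm (node (x ∷ W)).
Ip-node-∷ : ∀ x W L → Ip (node (x ∷ W)) (node L) ≡ ∑picks L (λ y R → Ip x y * Ip (node W) (node R))
Ip-node-∷ x W L = Ip-cases {node (x ∷ W)} {node L} matched unmatched
  where
    open ≡-Reasoning
    matched : node (x ∷ W) ≅ node L → symm (node (x ∷ W)) ≡ ∑picks L (λ y R → Ip x y * Ip (node W) (node R))
    matched e = sym (begin
      ∑picks L (λ y R → Ip x y * Ip (node W) (node R))     ≡⟨ ∑picks-cong L (λ yR↭L → term yR↭L (x ≅? _)) ⟩
      ∑picks L (λ y _ → δ (code x) (code y) * (symm x * symm (node W)))
        ≡⟨ ∑-*ʳ (picks L) (λ p → δ (code x) (code (proj₁ p))) _ ⟩
      ∑picks L (λ y _ → δ (code x) (code y)) * (symm x * symm (node W))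
        ≡⟨ cong (_* _) (trans (∑picks-fst L (δ (code x) ∘ code)) (sym (∑-map code L (δ (code x))))) ⟩
      ∑ (map code L) (δ (code x)) * (symm x * symm (node W))  ≡⟨ cong (_* _) (countIso≡∑-δ x L) ⟨
      countIso x L * (symm x * symm (node W))
        ≡⟨ cong (_* _) (countIso-cong {x} {x} {L} {x ∷ W} refl (↭-sym (node-≅⇒∼ {x ∷ W} {L} e))) ⟩
      countIso x (x ∷ W) * (symm x * symm (node W))
        ≡⟨ cong (λ d → (d + countIso x W) * (symm x * symm (node W))) (δ-≡ {code x} refl) ⟩
      suc (countIso x W) * (symm x * symm (node W))          ≡⟨ *-assoc (suc (countIso x W)) (symm x) _ ⟨
      suc (countIso x W) * symm x * symm (node W)            ≡⟨ symm-node-∷ x W ⟨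
      symm (node (x ∷ W))                                    ∎)
      where
        term : ∀ {y R} → y ∷ R ↭ L → Dec (x ≅ y)
             → Ip x y * Ip (node W) (node R) ≡ δ (code x) (code y) * (symm x * symm (node W))
        term {y} {R} yR↭L (yes ex) = begin
          Ip x y * Ip (node W) (node R)  ≡⟨ cong₂ _*_ (Ip-≅ {x} {y} ex) (Ip-≅ {node W} {node R} (∼⇒node-≅ {W} {R} W∼R)) ⟩
          symm x * symm (node W)         ≡⟨ +-identityʳ _ ⟨
          1 * (symm x * symm (node W))   ≡⟨ cong (_* _) (δ-≡ ex) ⟨
          δ (code x) (code y) * (symm x * symm (node W)) ∎
          where W∼R = ∷-∼⁻ ex (↭-trans (node-≅⇒∼ {x ∷ W} {L} e) (↭-sym (↭⇒∼ yR↭L)))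
        term {y} {R} yR↭L (no nx) =
          trans (cong (_* Ip (node W) (node R)) (Ip-≇ {x} {y} nx)) (cong (_* (symm x * symm (node W))) (sym (δ-≢ nx)))
    unmatched : ¬ node (x ∷ W) ≅ node L → 0 ≡ ∑picks L (λ y R → Ip x y * Ip (node W) (node R))
    unmatched ne = sym (trans (∑picks-cong L (λ yR↭L → term yR↭L (x ≅? _))) (∑-0 (picks L)))
      where
        term : ∀ {y R} → y ∷ R ↭ L → Dec (x ≅ y) → Ip x y * Ip (node W) (node R) ≡ 0
        term {y} {R} yR↭L (yes ex) = trans (cong (Ip x y *_) (Ip-≇ {node W} {node R} nW)) (*-zeroʳ (Ip x y))
          where nW : ¬ node W ≅ node R
                nW eW = ne (∼⇒node-≅ {x ∷ W} {L} (↭-trans (∷-∼ ex (node-≅⇒∼ {W} {R} eW)) (↭⇒∼ yR↭L)))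
        term {y} yR↭L (no nx) = cong (_* _) (Ip-≇ {x} {y} nx)

node-∷≇• : ∀ x W → ¬ node (x ∷ W) ≅ •
node-∷≇• x W e with () ← ↭-empty-inv (node-≅⇒∼ {x ∷ W} {[]} e)

Ip-node-↭ʳ : ∀ t → (λ W → Ip t (node W)) Preserves _↭_ ⟶ _≡_
Ip-node-↭ʳ t {W} {V} p = Ip-congʳ t {node W} {node V} (∼⇒node-≅ {W} {V} (↭⇒∼ p))

Ip-node-↭ˡ : ∀ s → (λ W → Ip (node W) s) Preserves _↭_ ⟶ _≡_
Ip-node-↭ˡ s {W} {V} p = Ip-congˡ {node W} {node V} s (∼⇒node-≅ {W} {V} (↭⇒∼ p))

-- When c = •, pruning its only leaf removes c from the forest c ∷ R.
∑pruned : (List Tree → ℕ) → Tree → List Tree → ℕ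
∑pruned F (node [])       R = F R
∑pruned F (node (x ∷ xs)) R = ∑ (prunes (node (x ∷ xs))) (λ c′ → F (c′ ∷ R))

∑pruned-∷ : ∀ {F} → F Preserves _↭_ ⟶ _≡_ → ∀ a c R → ∑pruned (F ∘ (a ∷_)) c R ≡ ∑pruned F c (a ∷ R)
∑pruned-∷ F-inv a (node [])       R = refl
∑pruned-∷ F-inv a (node (x ∷ xs)) R = ∑-cong (prunes (node (x ∷ xs))) (λ c′ → F-inv (↭.swap a c′ ↭-refl))

∑-prunesL : ∀ {F} → F Preserves _↭_ ⟶ _≡_ → ∀ U → ∑ (prunesL U) F ≡ ∑picks U (∑pruned F)

∑-map-∷-prunesL : ∀ {F} → F Preserves _↭_ ⟶ _≡_ → ∀ a U
                → ∑ (map (a ∷_) (prunesL U)) F ≡ ∑picks U (λ y R → ∑pruned F y (a ∷ R))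
∑-map-∷-prunesL {F} F-inv a U = begin
  ∑ (map (a ∷_) (prunesL U)) F           ≡⟨ ∑-map (a ∷_) (prunesL U) F ⟩
  ∑ (prunesL U) (F ∘ (a ∷_))             ≡⟨ ∑-prunesL (F-inv ∘ ↭.prep a) U ⟩
  ∑picks U (∑pruned (F ∘ (a ∷_)))        ≡⟨ ∑-cong (picks U) (λ p → ∑pruned-∷ F-inv a (proj₁ p) (proj₂ p)) ⟩
  ∑picks U (λ y R → ∑pruned F y (a ∷ R)) ∎
  where open ≡-Reasoning

∑-prunesL         F-inv []                   = refl
∑-prunesL {F}     F-inv (node [] ∷ U)        = begin
  F U + ∑ (map (• ∷_) (prunesL U)) F                         ≡⟨ cong (F U +_) (∑-map-∷-prunesL F-inv • U) ⟩
  F U + ∑picks U (λ y R → ∑pruned F y (• ∷ R))               ≡⟨ ∑picks-∷ • U (∑pruned F) ⟨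
  ∑picks (• ∷ U) (∑pruned F)                                 ∎
  where open ≡-Reasoning
∑-prunesL {F}     F-inv (node (x ∷ xs) ∷ U)  = begin
  ∑ (map (_∷ U) (prunes c) ++ map (c ∷_) (prunesL U)) F
    ≡⟨ ∑-++ (map (_∷ U) (prunes c)) _ F ⟩
  ∑ (map (_∷ U) (prunes c)) F + ∑ (map (c ∷_) (prunesL U)) F
    ≡⟨ cong₂ _+_ (∑-map (_∷ U) (prunes c) F) (∑-map-∷-prunesL F-inv c U) ⟩
  ∑pruned F c U + ∑picks U (λ y R → ∑pruned F y (c ∷ R))
    ≡⟨ ∑picks-∷ c U (∑pruned F) ⟨
  ∑picks (c ∷ U) (∑pruned F)
    ∎
  where open ≡-Reasoning
        c = node (x ∷ xs)

∑-graftsL : ∀ {F} → F Preserves _↭_ ⟶ _≡_ → ∀ V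
          → ∑ (graftsL V) F ≡ ∑picks V (λ d Q → ∑ (grafts d) (λ d′ → F (d′ ∷ Q)))
∑-graftsL         F-inv []      = refl
∑-graftsL {F}     F-inv (c ∷ V) = begin
  ∑ (map (_∷ V) (grafts c) ++ map (c ∷_) (graftsL V)) F
    ≡⟨ ∑-++ (map (_∷ V) (grafts c)) _ F ⟩
  ∑ (map (_∷ V) (grafts c)) F + ∑ (map (c ∷_) (graftsL V)) F
    ≡⟨ cong₂ _+_ (∑-map (_∷ V) (grafts c) F) (∑-map (c ∷_) (graftsL V) F) ⟩
  head + ∑ (graftsL V) (F ∘ (c ∷_))
    ≡⟨ cong (head +_) (∑-graftsL (F-inv ∘ ↭.prep c) V) ⟩
  head + ∑picks V (λ d Q → ∑ (grafts d) (λ d′ → F (c ∷ d′ ∷ Q)))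
    ≡⟨ cong (head +_) (∑-cong (picks V) (λ p → ∑-cong (grafts (proj₁ p)) (λ d′ → F-inv (↭.swap c d′ ↭-refl)))) ⟩
  head + ∑picks V (λ d Q → ∑ (grafts d) (λ d′ → F (d′ ∷ c ∷ Q)))
    ≡⟨ ∑picks-∷ c V (λ d Q → ∑ (grafts d) (λ d′ → F (d′ ∷ Q))) ⟨
  ∑picks (c ∷ V) (λ d Q → ∑ (grafts d) (λ d′ → F (d′ ∷ Q)))
    ∎
  where
    open ≡-Reasoning
    head : ℕ
    head = ∑ (grafts c) (λ c′ → F (c′ ∷ V))

Ip-node-∷-• : ∀ x W → Ip (node (x ∷ W)) • ≡ 0
Ip-node-∷-• x W = Ip-≇ {node (x ∷ W)} {•} (node-∷≇• x W)

∑-grafts-Ip-• : ∀ t → ∑ (grafts t) (λ s → Ip s •) ≡ 0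
∑-grafts-Ip-• (node [])       = Ip-node-∷-• • []
∑-grafts-Ip-• (node (c ∷ cs)) = begin
  Ip (node (• ∷ c ∷ cs)) • + ∑ (map node (left ++ right)) (λ s → Ip s •)
    ≡⟨ cong₂ _+_ (Ip-node-∷-• • (c ∷ cs)) (∑-map node (left ++ right) (λ s → Ip s •)) ⟩
  ∑ (left ++ right) (λ W → Ip (node W) •)
    ≡⟨ ∑-++ left right (λ W → Ip (node W) •) ⟩
  ∑ left (λ W → Ip (node W) •) + ∑ right (λ W → Ip (node W) •)
    ≡⟨ cong₂ _+_ (trans (∑-map (_∷ cs) (grafts c) _) (∑-zero (grafts c) (λ d → Ip-node-∷-• d cs)))
                 (trans (∑-map (c ∷_) (graftsL cs) _) (∑-zero (graftsL cs) (Ip-node-∷-• c))) ⟩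
  0                                                                          ∎
  where
    open ≡-Reasoning
    left right : List (List Tree)
    left  = map (_∷ cs) (grafts c)
    right = map (c ∷_) (graftsL cs)

PrunesGraftsAdjoint : Tree → Set
PrunesGraftsAdjoint T = ∀ t → ∑ (prunes T) (Ip t) ≡ ∑ (grafts t) (λ s → Ip s T)

∑pruned-Ip : ∀ V c R → PrunesGraftsAdjoint c
  → ∑pruned (λ W → Ip (node V) (node W)) c R
  ≡ Ip • c * Ip (node V) (node R) + ∑picks V (λ d Q → ∑ (grafts d) (λ d′ → Ip d′ c) * Ip (node Q) (node R))
∑pruned-Ip V (node []) R _ = sym (begin
  Ip • • * Ip (node V) (node R) + ∑picks V (λ d Q → ∑ (grafts d) (λ d′ → Ip d′ •) * Ip (node Q) (node R))
    ≡⟨ cong (Ip • • * Ip (node V) (node R) +_)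
            (∑-zero (picks V) (λ p → cong (_* Ip (node (proj₂ p)) (node R)) (∑-grafts-Ip-• (proj₁ p)))) ⟩
  Ip • • * Ip (node V) (node R) + 0  ≡⟨ +-identityʳ _ ⟩
  1 * Ip (node V) (node R)           ≡⟨ *-identityˡ _ ⟩
  Ip (node V) (node R)               ∎)
  where open ≡-Reasoning
∑pruned-Ip V c@(node (x ∷ xs)) R adjoint-c = begin
  ∑ (prunes c) (λ c′ → Ip (node V) (node (c′ ∷ R)))
    ≡⟨ ∑-cong (prunes c) (λ c′ → trans (Ip-sym (node V) (node (c′ ∷ R))) (Ip-node-∷ c′ R V)) ⟩
  ∑ (prunes c) (λ c′ → ∑picks V (λ d Q → Ip c′ d * Ip (node R) (node Q)))
    ≡⟨ ∑-comm (prunes c) (picks V) (λ c′ p → Ip c′ (proj₁ p) * Ip (node R) (node (proj₂ p))) ⟩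
  ∑picks V (λ d Q → ∑ (prunes c) (λ c′ → Ip c′ d * Ip (node R) (node Q)))
    ≡⟨ ∑-cong (picks V) (λ p → ∑-*ʳ (prunes c) (λ c′ → Ip c′ (proj₁ p)) _) ⟩
  ∑picks V (λ d Q → ∑ (prunes c) (λ c′ → Ip c′ d) * Ip (node R) (node Q))
    ≡⟨ ∑-cong (picks V) (λ p → cong₂ _*_ (transpose (proj₁ p)) (Ip-sym (node R) (node (proj₂ p)))) ⟩
  ∑picks V (λ d Q → ∑ (grafts d) (λ d′ → Ip d′ c) * Ip (node Q) (node R))
    ≡⟨ cong (λ n → n * Ip (node V) (node R) + ∑picks V (λ d Q → ∑ (grafts d) (λ d′ → Ip d′ c) * Ip (node Q) (node R)))
            (Ip-≇ {•} {c} (node-∷≇• x xs ∘ sym)) ⟨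
  Ip • c * Ip (node V) (node R) + ∑picks V (λ d Q → ∑ (grafts d) (λ d′ → Ip d′ c) * Ip (node Q) (node R)) ∎
  where
    open ≡-Reasoning
    transpose : ∀ d → ∑ (prunes c) (λ c′ → Ip c′ d) ≡ ∑ (grafts d) (λ d′ → Ip d′ c)
    transpose d = trans (∑-cong (prunes c) (λ c′ → Ip-sym c′ d)) (adjoint-c d)

∑grafted-Ip : ∀ U d Q → ∑ (grafts d) (λ d′ → Ip (node (d′ ∷ Q)) (node U))
            ≡ ∑picks U (λ c R → ∑ (grafts d) (λ d′ → Ip d′ c) * Ip (node Q) (node R))
∑grafted-Ip U d Q = begin
  ∑ (grafts d) (λ d′ → Ip (node (d′ ∷ Q)) (node U))
    ≡⟨ ∑-cong (grafts d) (λ d′ → Ip-node-∷ d′ Q U) ⟩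
  ∑ (grafts d) (λ d′ → ∑picks U (λ c R → Ip d′ c * Ip (node Q) (node R)))
    ≡⟨ ∑-comm (grafts d) (picks U) (λ d′ p → Ip d′ (proj₁ p) * Ip (node Q) (node (proj₂ p))) ⟩
  ∑picks U (λ c R → ∑ (grafts d) (λ d′ → Ip d′ c * Ip (node Q) (node R)))
    ≡⟨ ∑-cong (picks U) (λ p → ∑-*ʳ (grafts d) (λ d′ → Ip d′ (proj₁ p)) _) ⟩
  ∑picks U (λ c R → ∑ (grafts d) (λ d′ → Ip d′ c) * Ip (node Q) (node R)) ∎
  where open ≡-Reasoning

mutual
  prunes-grafts-adjoint : ∀ T → PrunesGraftsAdjoint T
  prunes-grafts-adjoint (node U) (node V) = begin
    ∑ (prunes (node U)) (Ip (node V))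
      ≡⟨ ∑-map node (prunesL U) (Ip (node V)) ⟩
    ∑ (prunesL U) (λ W → Ip (node V) (node W))
      ≡⟨ ∑-prunesL (Ip-node-↭ʳ (node V)) U ⟩
    ∑picks U (∑pruned (λ W → Ip (node V) (node W)))
      ≡⟨ ∑picks-cong U (λ {c} {R} cR↭U → ∑pruned-Ip V c R (lookup (children-adjoint U) (∈-resp-↭ cR↭U (Any.here refl)))) ⟩
    ∑picks U (λ c R → Ip • c * Ip (node V) (node R) + H c R)
      ≡⟨ ∑-+ (picks U) (uncurry (λ c R → Ip • c * Ip (node V) (node R))) (uncurry H) ⟩
    ∑picks U (λ c R → Ip • c * Ip (node V) (node R)) + ∑picks U H
      ≡⟨ cong₂ _+_ (Ip-node-∷ • V U)
                   (∑-comm (picks V) (picks U) (λ q p → G (proj₁ q) (proj₁ p) * Ip (node (proj₂ q)) (node (proj₂ p)))) ⟨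
    Ip (node (• ∷ V)) (node U) + ∑picks V (λ d Q → ∑picks U (λ c R → G d c * Ip (node Q) (node R)))
      ≡⟨ cong (Ip (node (• ∷ V)) (node U) +_) (∑-cong (picks V) (λ q → ∑grafted-Ip U (proj₁ q) (proj₂ q))) ⟨
    Ip (node (• ∷ V)) (node U) + ∑picks V (λ d Q → ∑ (grafts d) (λ d′ → Ip (node (d′ ∷ Q)) (node U)))
      ≡⟨ cong (Ip (node (• ∷ V)) (node U) +_) (∑-graftsL (Ip-node-↭ˡ (node U)) V) ⟨
    Ip (node (• ∷ V)) (node U) + ∑ (graftsL V) (λ W → Ip (node W) (node U))
      ≡⟨ cong (Ip (node (• ∷ V)) (node U) +_) (∑-map node (graftsL V) (λ s → Ip s (node U))) ⟨
    ∑ (grafts (node V)) (λ s → Ip s (node U)) ∎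
    where
      open ≡-Reasoning
      G : Tree → Tree → ℕ
      G d c = ∑ (grafts d) (λ d′ → Ip d′ c)
      H : Tree → List Tree → ℕ
      H c R = ∑picks V (λ d Q → G d c * Ip (node Q) (node R))

  children-adjoint : ∀ U → All PrunesGraftsAdjoint U
  children-adjoint []      = []
  children-adjoint (c ∷ U) = prunes-grafts-adjoint c ∷ children-adjoint U

graft-prune-balance : ∀ V u → ∑ (graftsL u) (λ W → Ip (node V) (node W)) + Ip (node (• ∷ u)) (node V)
                            ≡ ∑ (prunes (node V)) (λ s → Ip s (node u))
graft-prune-balance V u = begin
  ∑ (graftsL u) (λ W → Ip (node V) (node W)) + Ip (node (• ∷ u)) (node V)
    ≡⟨ +-comm _ (Ip (node (• ∷ u)) (node V)) ⟩
  Ip (node (• ∷ u)) (node V) + ∑ (graftsL u) (λ W → Ip (node V) (node W))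
    ≡⟨ cong (Ip (node (• ∷ u)) (node V) +_) (∑-cong (graftsL u) (λ W → Ip-sym (node V) (node W))) ⟩
  Ip (node (• ∷ u)) (node V) + ∑ (graftsL u) (λ W → Ip (node W) (node V))
    ≡⟨ cong (Ip (node (• ∷ u)) (node V) +_) (∑-map node (graftsL u) (λ s → Ip s (node V))) ⟨
  ∑ (grafts (node u)) (λ s → Ip s (node V))
    ≡⟨ prunes-grafts-adjoint (node V) (node u) ⟨
  ∑ (prunes (node V)) (Ip (node u))
    ≡⟨ ∑-cong (prunes (node V)) (Ip-sym (node u)) ⟩
  ∑ (prunes (node V)) (λ s → Ip s (node u)) ∎
  where open ≡-Reasoning

leafAt : ℕ → List (ℕ × Tree)
leafAt i = (i , •) ∷ []

here-leafAt-≢ : ∀ {i n} → i ≢ n → here (leafAt i) n ≡ []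
here-leafAt-≢ {i} {n} i≢n with i ℕ.≡ᵇ n in e
... | true  = contradiction (≡ᵇ⇒≡ i n (subst T (sym e) _)) i≢n
... | false = refl

here-leafAt-≡ : ∀ n → here (leafAt n) n ≡ • ∷ []
here-leafAt-≡ n with n ℕ.≡ᵇ n in e
... | true  = refl
... | false = contradiction (subst T e (≡⇒≡ᵇ n n refl)) λ ()

-- att A n t numbers the vertices of t in preorder from n; its second component is the next free number.
mutual
  att-next : ∀ A n t → proj₂ (att A n t) ≡ n + size t
  att-next A n (node cs) = trans (attL-next A (suc n) cs) (sym (+-suc n (sizeL cs)))

  attL-next : ∀ A n cs → proj₂ (attL A n cs) ≡ n + sizeL cs
  attL-next A n []       = sym (+-identityʳ n)
  attL-next A n (c ∷ cs) rewrite att-next A n c =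
    trans (attL-next A (n + size c) cs) (+-assoc n (size c) (sizeL cs))

attL-∷ : ∀ A n c cs → proj₁ (attL A n (c ∷ cs)) ≡ proj₁ (att A n c) ∷ proj₁ (attL A (n + size c) cs)
attL-∷ A n c cs rewrite att-next A n c = refl

Outside : ℕ → ℕ → ℕ → Set
Outside i n k = i < n ⊎ n + k ≤ i

outside-≢ : ∀ {i n k} → Outside i n (suc k) → i ≢ n
outside-≢ (inj₁ i<n)         refl = <-irrefl refl i<n
outside-≢ {i} (inj₂ n+1+k≤i) refl = m+1+n≰m i n+1+k≤i

outside-suc : ∀ {i n k} → Outside i n (suc k) → Outside i (suc n) k
outside-suc (inj₁ i<n)                 = inj₁ (m<n⇒m<1+n i<n)
outside-suc {i} {n} {k} (inj₂ n+1+k≤i) = inj₂ (subst (_≤ i) (+-suc n k) n+1+k≤i)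

mutual
  att-outside : ∀ {i} n t → Outside i n (size t) → proj₁ (att (leafAt i) n t) ≡ t
  att-outside n (node cs) out rewrite here-leafAt-≢ (outside-≢ out) =
    cong node (attL-outside (suc n) cs (outside-suc out))

  attL-outside : ∀ {i} n cs → Outside i n (sizeL cs) → proj₁ (attL (leafAt i) n cs) ≡ cs
  attL-outside n []       out = refl
  attL-outside {i} n (c ∷ cs) out = trans (attL-∷ (leafAt i) n c cs)
    (cong₂ _∷_ (att-outside n c (outside-left out)) (attL-outside (n + size c) cs (outside-right out)))
    where
      outside-left : Outside i n (size c + sizeL cs) → Outside i n (size c)
      outside-left (inj₁ i<n)   = inj₁ i<n
      outside-left (inj₂ n+k≤i) = inj₂ (≤-trans (+-monoʳ-≤ n (m≤m+n (size c) (sizeL cs))) n+k≤i)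
      outside-right : Outside i n (size c + sizeL cs) → Outside i (n + size c) (sizeL cs)
      outside-right (inj₁ i<n)   = inj₁ (<-≤-trans i<n (m≤m+n n (size c)))
      outside-right (inj₂ n+k≤i) = inj₂ (subst (_≤ i) (sym (+-assoc n (size c) (sizeL cs))) n+k≤i)

range : ℕ → ℕ → List ℕ
range m zero    = []
range m (suc k) = m ∷ range (suc m) k

range-++ : ∀ m a b → range m (a + b) ≡ range m a ++ range (m + a) b
range-++ m zero    b rewrite +-identityʳ m = refl
range-++ m (suc a) b rewrite +-suc m a     = cong (m ∷_) (range-++ (suc m) a b)

range-suc : ∀ m k → range (suc m) k ≡ map suc (range m k)
range-suc m zero    = refl
range-suc m (suc k) = cong (suc m ∷_) (range-suc (suc m) k)

upTo≡range : ∀ k → upTo k ≡ range 0 k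
upTo≡range zero    = refl
upTo≡range (suc k) = cong (0 ∷_) (begin
  applyUpTo suc k       ≡⟨ map-applyUpTo id suc k ⟨
  map suc (upTo k)      ≡⟨ cong (map suc) (upTo≡range k) ⟩
  map suc (range 0 k)   ≡⟨ range-suc 0 k ⟨
  range 1 k             ∎)
  where open ≡-Reasoning

map-cong-range : ∀ {f g : ℕ → A} m k → (∀ {i} → m ≤ i → i < m + k → f i ≡ g i) → map f (range m k) ≡ map g (range m k)
map-cong-range m zero    p = refl
map-cong-range m (suc k) p = cong₂ _∷_ (p ≤-refl (subst (m <_) (sym (+-suc m k)) (m<m+1+k)))
  (map-cong-range (suc m) k (λ {i} m<i i<… → p (<⇒≤ m<i) (subst (i <_) (sym (+-suc m k)) i<…)))
  where m<m+1+k = s≤s (m≤m+n m k)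

mutual
  att-inside : ∀ n t → map (λ i → proj₁ (att (leafAt i) n t)) (range n (size t)) ≡ grafts t
  att-inside n (node cs) = cong₂ _∷_ root (begin
    map (λ i → node (here (leafAt i) n ++ proj₁ (attL (leafAt i) (suc n) cs))) (range (suc n) (sizeL cs))
      ≡⟨ map-cong-range (suc n) (sizeL cs) (λ n<i _ → below-root n<i) ⟩
    map (node ∘ λ i → proj₁ (attL (leafAt i) (suc n) cs)) (range (suc n) (sizeL cs))
      ≡⟨ map-∘ (range (suc n) (sizeL cs)) ⟩
    map node (map (λ i → proj₁ (attL (leafAt i) (suc n) cs)) (range (suc n) (sizeL cs)))
      ≡⟨ cong (map node) (attL-inside (suc n) cs) ⟩
    map node (graftsL cs) ∎)
    where
      open ≡-Reasoning
      below-root : ∀ {i} → n < i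
                 → node (here (leafAt i) n ++ proj₁ (attL (leafAt i) (suc n) cs)) ≡ node (proj₁ (attL (leafAt i) (suc n) cs))
      below-root {i} n<i =
        cong (λ h → node (h ++ proj₁ (attL (leafAt i) (suc n) cs))) (here-leafAt-≢ (λ i≡n → <-irrefl (sym i≡n) n<i))
      root : proj₁ (att (leafAt n) n (node cs)) ≡ node (• ∷ cs)
      root rewrite here-leafAt-≡ n = cong (λ cs′ → node (• ∷ cs′)) (attL-outside (suc n) cs (inj₁ ≤-refl))

  attL-inside : ∀ n cs → map (λ i → proj₁ (attL (leafAt i) n cs)) (range n (sizeL cs)) ≡ graftsL cs
  attL-inside n []       = refl
  attL-inside n (c ∷ cs) = begin
    map F (range n (size c + sizeL cs))
      ≡⟨ cong (map F) (range-++ n (size c) (sizeL cs)) ⟩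
    map F (range n (size c) ++ range (n + size c) (sizeL cs))
      ≡⟨ map-++ F (range n (size c)) _ ⟩
    map F (range n (size c)) ++ map F (range (n + size c) (sizeL cs))
      ≡⟨ cong₂ _++_ (map-cong-range n (size c) in-c) (map-cong-range (n + size c) (sizeL cs) in-cs) ⟩
    map ((_∷ cs) ∘ λ i → proj₁ (att (leafAt i) n c)) (range n (size c))
      ++ map ((c ∷_) ∘ λ i → proj₁ (attL (leafAt i) (n + size c) cs)) (range (n + size c) (sizeL cs))
      ≡⟨ cong₂ _++_ (map-∘ (range n (size c))) (map-∘ (range (n + size c) (sizeL cs))) ⟩
    map (_∷ cs) (map (λ i → proj₁ (att (leafAt i) n c)) (range n (size c)))
      ++ map (c ∷_) (map (λ i → proj₁ (attL (leafAt i) (n + size c) cs)) (range (n + size c) (sizeL cs)))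
      ≡⟨ cong₂ _++_ (cong (map (_∷ cs)) (att-inside n c)) (cong (map (c ∷_)) (attL-inside (n + size c) cs)) ⟩
    map (_∷ cs) (grafts c) ++ map (c ∷_) (graftsL cs) ∎
    where
      open ≡-Reasoning
      F : ℕ → List Tree
      F i = proj₁ (attL (leafAt i) n (c ∷ cs))
      in-c : ∀ {i} → n ≤ i → i < n + size c → F i ≡ proj₁ (att (leafAt i) n c) ∷ cs
      in-c {i} _ i<n+c = trans (attL-∷ (leafAt i) n c cs) (cong (_ ∷_) (attL-outside (n + size c) cs (inj₁ i<n+c)))
      in-cs : ∀ {i} → n + size c ≤ i → i < n + size c + sizeL cs → F i ≡ c ∷ proj₁ (attL (leafAt i) (n + size c) cs)
      in-cs {i} n+c≤i _ =
        trans (attL-∷ (leafAt i) n c cs) (cong (_∷ proj₁ (attL (leafAt i) (n + size c) cs)) (att-outside n c (inj₂ n+c≤i)))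

GL-B₊• : ∀ t → GL (node (• ∷ [])) t ≡ grafts t
GL-B₊• t = begin
  map (λ A → proj₁ (att A 0 t)) (concatMap (λ i → leafAt i ∷ []) (upTo (size t)))
    ≡⟨ cong (map (λ A → proj₁ (att A 0 t))) (trans (sym (concatMap-map [_] leafAt (upTo (size t)))) (concatMap-pure _)) ⟩
  map (λ A → proj₁ (att A 0 t)) (map leafAt (upTo (size t)))
    ≡⟨ map-∘ (upTo (size t)) ⟨
  map (λ i → proj₁ (att (leafAt i) 0 t)) (upTo (size t))
    ≡⟨ cong (map (λ i → proj₁ (att (leafAt i) 0 t))) (upTo≡range (size t)) ⟩
  map (λ i → proj₁ (att (leafAt i) 0 t)) (range 0 (size t))
    ≡⟨ att-inside 0 t ⟩
  grafts t ∎
  where open ≡-Reasoning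

module _ {c ℓ} (k : CommutativeRing c ℓ) where

  private module R = CommutativeRing k
  open R using (Carrier; _≈_; 0#; 1#; -_; +-cong; +-congˡ; +-congʳ; *-congʳ; +-identityˡ; -‿cong)
    renaming (_+_ to _+ᴿ_; _*_ to _*ᴿ_)
  open import Algebra.Properties.Ring R.ring using (-‿distribˡ-*; -‿+-comm; -0#≈0#)
  import Relation.Binary.Reasoning.Setoid R.setoid as ≈-Reasoning

  ⟦_⟧ : ℕ → Carrier
  ⟦_⟧ = fromℕ k

  ⟦+⟧ : ∀ a b → ⟦ a + b ⟧ ≈ ⟦ a ⟧ +ᴿ ⟦ b ⟧
  ⟦+⟧ zero    b = R.sym (+-identityˡ ⟦ b ⟧)
  ⟦+⟧ (suc a) b = R.trans (+-congˡ (⟦+⟧ a b)) (R.sym (R.+-assoc 1# ⟦ a ⟧ ⟦ b ⟧))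

  ⟦⟧-difference : ∀ {x a} b → x + b ≡ a → ⟦ x ⟧ ≈ ⟦ a ⟧ +ᴿ - ⟦ b ⟧
  ⟦⟧-difference {x} {a} b x+b≡a = begin
    ⟦ x ⟧                          ≈⟨ R.+-identityʳ ⟦ x ⟧ ⟨
    ⟦ x ⟧ +ᴿ 0#                    ≈⟨ +-congˡ (R.-‿inverseʳ ⟦ b ⟧) ⟨
    ⟦ x ⟧ +ᴿ (⟦ b ⟧ +ᴿ - ⟦ b ⟧)    ≈⟨ R.+-assoc ⟦ x ⟧ ⟦ b ⟧ (- ⟦ b ⟧) ⟨
    (⟦ x ⟧ +ᴿ ⟦ b ⟧) +ᴿ - ⟦ b ⟧    ≈⟨ +-congʳ (⟦+⟧ x b) ⟨
    ⟦ x + b ⟧ +ᴿ - ⟦ b ⟧           ≡⟨ cong (λ n → ⟦ n ⟧ +ᴿ - ⟦ b ⟧) x+b≡a ⟩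
    ⟦ a ⟧ +ᴿ - ⟦ b ⟧               ∎
    where open ≈-Reasoning

  units : List A → List (Carrier × A)
  units = map (1# ,_)

  weighted : (A → Carrier) → List (Carrier × A) → Carrier
  weighted g v = sumR k (map (λ q → proj₁ q *ᴿ g (proj₂ q)) v)

  weighted-units : ∀ {g : A → Carrier} {F} L → (∀ x → g x ≈ ⟦ F x ⟧) → weighted g (units L) ≈ ⟦ ∑ L F ⟧
  weighted-units         []      g≈F = R.refl
  weighted-units {F = F} (x ∷ L) g≈F = begin
    1# *ᴿ _ +ᴿ weighted _ (units L)  ≈⟨ +-cong (R.trans (R.*-identityˡ _) (g≈F x)) (weighted-units L g≈F) ⟩
    ⟦ F x ⟧ +ᴿ ⟦ ∑ L F ⟧             ≈⟨ ⟦+⟧ (F x) (∑ L F) ⟨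
    ⟦ F x + ∑ L F ⟧                  ∎
    where open ≈-Reasoning

  weighted-++ : ∀ (g : A → Carrier) v w → weighted g (v ++ w) ≈ weighted g v +ᴿ weighted g w
  weighted-++ g []      w = R.sym (+-identityˡ _)
  weighted-++ g (q ∷ v) w = R.trans (+-congˡ (weighted-++ g v w)) (R.sym (R.+-assoc _ _ _))

  weighted-negate : ∀ (g : A → Carrier) v → weighted g (map (λ q → (- proj₁ q , proj₂ q)) v) ≈ - weighted g v
  weighted-negate g []      = R.sym -0#≈0#
  weighted-negate g (q ∷ v) = R.trans (+-cong (R.sym (-‿distribˡ-* _ _)) (weighted-negate g v)) (-‿+-comm _ _)

  weighted-map₂ : ∀ (g : B → Carrier) (f : A → B) v → weighted g (map (map₂ f) v) ≡ weighted (g ∘ f) v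
  weighted-map₂ g f v = cong (sumR k) (sym (map-∘ v))

  units-map : ∀ (f : A → B) L → map (map₂ f) (units L) ≡ units (map f L)
  units-map f L = trans (sym (map-∘ L)) (map-∘ L)

  weighted-1* : ∀ (g : A → Carrier) v → weighted g (map (map₁ (1# *ᴿ_)) v) ≈ weighted g v
  weighted-1* g []      = R.refl
  weighted-1* g (q ∷ v) = +-cong (*-congʳ (R.*-identityˡ (proj₁ q))) (weighted-1* g v)

  ip≡⟦Ip⟧ : ∀ t s → ip k t s ≡ ⟦ Ip t s ⟧
  ip≡⟦Ip⟧ t s with isoᵇ t s
  ... | true  = refl
  ... | false = refl

  χ-basis : ∀ t m → χ k (basis k t) m ≈ ⟦ Ip t (node m) ⟧
  χ-basis t m = R.trans (R.+-identityʳ _) (R.trans (R.*-identityˡ _) (R.reflexive (ip≡⟦Ip⟧ t (node m))))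

  derivMon-∷ : ∀ D t u L → D t ≡ vecToPoly k (units L)
             → derivMon k D (t ∷ u) ≡ units (map (_∷ u) L) ++ map (map₂ (t ∷_)) (derivMon k D u)
  derivMon-∷ D t u L Dt = cong (_++ map (map₂ (t ∷_)) (derivMon k D u)) (begin
    map (map₂ (_++ u)) (D t)                         ≡⟨ cong (map (map₂ (_++ u))) Dt ⟩
    map (map₂ (_++ u)) (map (map₂ [_]) (units L))    ≡⟨ cong (map (map₂ (_++ u))) (units-map [_] L) ⟩
    map (map₂ (_++ u)) (units (map [_] L))           ≡⟨ units-map (_++ u) (map [_] L) ⟩
    units (map (_++ u) (map [_] L))                  ≡⟨ cong units (map-∘ L) ⟨
    units (map (_∷ u) L)                             ∎)
    where open ≡-Reasoning

  mutual
    P≡units-prunesL : ∀ u → P k u ≡ units (prunesL u)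
    P≡units-prunesL []                     = refl
    P≡units-prunesL (node [] ∷ u)          = cong ((1# , u) ∷_) (P-tail • u)
    P≡units-prunesL (c@(node (_ ∷ _)) ∷ u) = begin
      P k (c ∷ u)                                                        ≡⟨ derivMon-∷ (Pgen k) c u (prunes c) refl ⟩
      units (map (_∷ u) (prunes c)) ++ map (map₂ (c ∷_)) (P k u)         ≡⟨ cong (units (map (_∷ u) (prunes c)) ++_) (P-tail c u) ⟩
      units (map (_∷ u) (prunes c)) ++ units (map (c ∷_) (prunesL u))    ≡⟨ map-++ (1# ,_) (map (_∷ u) (prunes c)) _ ⟨
      units (prunesL (c ∷ u))                                            ∎
      where open ≡-Reasoning

    P-tail : ∀ c u → map (map₂ (c ∷_)) (P k u) ≡ units (map (c ∷_) (prunesL u))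
    P-tail c u = trans (cong (map (map₂ (c ∷_))) (P≡units-prunesL u)) (units-map (c ∷_) (prunesL u))

  N≡units-graftsL : ∀ u → N k u ≡ units (graftsL u)
  N≡units-graftsL []      = refl
  N≡units-graftsL (c ∷ u) = begin
    N k (c ∷ u)                                                        ≡⟨ derivMon-∷ (Ngen k) c u (grafts c) refl ⟩
    units (map (_∷ u) (grafts c)) ++ map (map₂ (c ∷_)) (N k u)         ≡⟨ cong (units (map (_∷ u) (grafts c)) ++_) tail ⟩
    units (map (_∷ u) (grafts c)) ++ units (map (c ∷_) (graftsL u))    ≡⟨ map-++ (1# ,_) (map (_∷ u) (grafts c)) _ ⟨
    units (graftsL (c ∷ u))                                            ∎
    where
      open ≡-Reasoning
      tail : map (map₂ (c ∷_)) (N k u) ≡ units (map (c ∷_) (graftsL u))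
      tail = trans (cong (map (map₂ (c ∷_))) (N≡units-graftsL u)) (units-map (c ∷_) (graftsL u))

  weighted-∂∂• : ∀ V {φ : Mon k → Carrier} {Φ : List Tree → ℕ} → (∀ m → φ m ≈ ⟦ Φ m ⟧)
               → weighted φ (derivMon k (∂gen k) V) ≈ ⟦ ∑picks V (λ y R → Ip • y * Φ R) ⟧
  weighted-∂∂• []                   φ≈Φ = R.refl
  weighted-∂∂• (node [] ∷ V) {φ} {Φ} φ≈Φ = begin
    1# *ᴿ φ V +ᴿ weighted φ (map (map₂ (• ∷_)) (derivMon k (∂gen k) V))
      ≈⟨ +-cong (R.trans (R.*-identityˡ _) (φ≈Φ V))
                (R.trans (R.reflexive (weighted-map₂ φ (• ∷_) (derivMon k (∂gen k) V))) (weighted-∂∂• V (φ≈Φ ∘ (• ∷_)))) ⟩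
    ⟦ Φ V ⟧ +ᴿ ⟦ ∑picks V (λ y R → Ip • y * Φ (• ∷ R)) ⟧
      ≈⟨ ⟦+⟧ (Φ V) _ ⟨
    ⟦ Φ V + ∑picks V (λ y R → Ip • y * Φ (• ∷ R)) ⟧
      ≡⟨ cong (λ n → ⟦ n + ∑picks V (λ y R → Ip • y * Φ (• ∷ R)) ⟧) (+-identityʳ (Φ V)) ⟨
    ⟦ Ip • • * Φ V + ∑picks V (λ y R → Ip • y * Φ (• ∷ R)) ⟧
      ≡⟨ cong ⟦_⟧ (∑picks-∷ • V (λ y R → Ip • y * Φ R)) ⟨
    ⟦ ∑picks (• ∷ V) (λ y R → Ip • y * Φ R) ⟧ ∎
    where open ≈-Reasoning
  weighted-∂∂• (c@(node (x ∷ xs)) ∷ V) {φ} {Φ} φ≈Φ = begin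
    weighted φ (map (map₂ (c ∷_)) (derivMon k (∂gen k) V))
      ≡⟨ weighted-map₂ φ (c ∷_) (derivMon k (∂gen k) V) ⟩
    weighted (φ ∘ (c ∷_)) (derivMon k (∂gen k) V)
      ≈⟨ weighted-∂∂• V (φ≈Φ ∘ (c ∷_)) ⟩
    ⟦ ∑picks V (λ y R → Ip • y * Φ (c ∷ R)) ⟧
      ≡⟨ cong (λ n → ⟦ n * Φ V + ∑picks V (λ y R → Ip • y * Φ (c ∷ R)) ⟧) (Ip-≇ {•} {c} (node-∷≇• x xs ∘ sym)) ⟨
    ⟦ Ip • c * Φ V + ∑picks V (λ y R → Ip • y * Φ (c ∷ R)) ⟧
      ≡⟨ cong ⟦_⟧ (∑picks-∷ c V (λ y R → Ip • y * Φ R)) ⟨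
    ⟦ ∑picks (c ∷ V) (λ y R → Ip • y * Φ R) ⟧ ∎
    where open ≈-Reasoning

  P*-χ : ∀ t → _≈D_ k (P* k (χ k (basis k t))) (χ k (𝔑 k t))
  P*-χ t u = begin
    weighted (χ k (basis k t)) (P k u)              ≡⟨ cong (weighted (χ k (basis k t))) (P≡units-prunesL u) ⟩
    weighted (χ k (basis k t)) (units (prunesL u))  ≈⟨ weighted-units (prunesL u) (χ-basis t) ⟩
    ⟦ ∑ (prunesL u) (λ W → Ip t (node W)) ⟧         ≡⟨ cong ⟦_⟧ (∑-map node (prunesL u) (Ip t)) ⟨
    ⟦ ∑ (prunes (node u)) (Ip t) ⟧                  ≡⟨ cong ⟦_⟧ (prunes-grafts-adjoint (node u) t) ⟩
    ⟦ ∑ (grafts t) (λ s → Ip s (node u)) ⟧          ≈⟨ weighted-units (grafts t) (λ s → R.reflexive (ip≡⟦Ip⟧ s (node u))) ⟨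
    χ k (𝔑 k t) u                                   ∎
    where open ≈-Reasoning

  coeff-units-cong : ∀ {a b} → a ≈ b → ∀ L s → coeff k (map (a ,_) L) s ≈ coeff k (map (b ,_) L) s
  coeff-units-cong a≈b []      s = R.refl
  coeff-units-cong a≈b (x ∷ L) s with isoᵇ x s
  ... | true  = +-cong a≈b (coeff-units-cong a≈b L s)
  ... | false = +-congˡ (coeff-units-cong a≈b L s)

  𝔑≈B₊•∘GL : ∀ t → _≈V_ k (𝔑 k t) (_∘GL_ k (basis k (node (• ∷ []))) (basis k t))
  𝔑≈B₊•∘GL t s = begin
    coeff k (units (grafts t)) s                               ≈⟨ coeff-units-cong (R.sym (R.*-identityˡ 1#)) (grafts t) s ⟩
    coeff k (map (1# *ᴿ 1# ,_) (grafts t)) s                   ≡⟨ cong (λ L → coeff k (map (1# *ᴿ 1# ,_) L) s) (GL-B₊• t) ⟨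
    coeff k product s
      ≡⟨ cong (λ v → coeff k v s) (trans (++-identityʳ (product ++ [])) (++-identityʳ product)) ⟨
    coeff k (_∘GL_ k (basis k (node (• ∷ []))) (basis k t)) s  ∎
    where
      open ≈-Reasoning
      product : Vect k
      product = map (1# *ᴿ 1# ,_) (GL (node (• ∷ [])) t)

  χ-𝔓 : ∀ t u → χ k (𝔓 k t) u ≈ ⟦ ∑ (prunes t) (λ s → Ip s (node u)) ⟧
  χ-𝔓 (node [])       u = R.refl
  χ-𝔓 (node (x ∷ xs)) u = weighted-units (prunes (node (x ∷ xs))) (λ s → R.reflexive (ip≡⟦Ip⟧ s (node u)))

  χ-B₊∂∂• : ∀ V u → χ k (B₊ k (∂∂• k ((1# , V) ∷ []))) u ≈ ⟦ Ip (node (• ∷ u)) (node V) ⟧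
  χ-B₊∂∂• V u = begin
    weighted g (B₊ k (map (map₁ (1# *ᴿ_)) D ++ []))  ≡⟨ cong (weighted g ∘ B₊ k) (++-identityʳ (map (map₁ (1# *ᴿ_)) D)) ⟩
    weighted g (B₊ k (map (map₁ (1# *ᴿ_)) D))        ≡⟨ weighted-map₂ g node (map (map₁ (1# *ᴿ_)) D) ⟩
    weighted (g ∘ node) (map (map₁ (1# *ᴿ_)) D)      ≈⟨ weighted-1* (g ∘ node) D ⟩
    weighted (g ∘ node) D                            ≈⟨ weighted-∂∂• V (λ m → R.reflexive (ip-node-u m)) ⟩
    ⟦ ∑picks V (λ y R → Ip • y * Ip (node u) (node R)) ⟧  ≡⟨ cong ⟦_⟧ (Ip-node-∷ • u V) ⟨
    ⟦ Ip (node (• ∷ u)) (node V) ⟧                   ∎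
    where
      open ≈-Reasoning
      g : Tree → Carrier
      g s = ip k s (node u)
      D : Poly k
      D = derivMon k (∂gen k) V
      ip-node-u : ∀ m → ip k (node m) (node u) ≡ ⟦ Ip (node u) (node m) ⟧
      ip-node-u m = trans (ip≡⟦Ip⟧ (node m) (node u)) (cong ⟦_⟧ (Ip-sym (node m) (node u)))

  N*-χ : ∀ t → _≈D_ k (N* k (χ k (basis k t))) (χ k (_−V_ k (𝔓 k t) (B₊ k (∂∂• k ((1# , B₋ k t) ∷ [])))))
  N*-χ (node V) u = begin
    weighted (χ k (basis k (node V))) (N k u)               ≡⟨ cong (weighted (χ k (basis k (node V)))) (N≡units-graftsL u) ⟩
    weighted (χ k (basis k (node V))) (units (graftsL u))   ≈⟨ weighted-units (graftsL u) (χ-basis (node V)) ⟩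
    ⟦ ∑ (graftsL u) (λ W → Ip (node V) (node W)) ⟧
      ≈⟨ ⟦⟧-difference (Ip (node (• ∷ u)) (node V)) (graft-prune-balance V u) ⟩
    ⟦ ∑ (prunes (node V)) (λ s → Ip s (node u)) ⟧ +ᴿ - ⟦ Ip (node (• ∷ u)) (node V) ⟧
      ≈⟨ +-cong (χ-𝔓 (node V) u) (-‿cong (χ-B₊∂∂• V u)) ⟨
    χ k (𝔓 k (node V)) u +ᴿ - χ k ∂part u                   ≈⟨ +-congˡ (weighted-negate g ∂part) ⟨
    χ k (𝔓 k (node V)) u +ᴿ weighted g (map (λ q → (- proj₁ q , proj₂ q)) ∂part)
      ≈⟨ weighted-++ g (𝔓 k (node V)) _ ⟨
    χ k (_−V_ k (𝔓 k (node V)) ∂part) u                     ∎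
    where
      open ≈-Reasoning
      g : Tree → Carrier
      g s = ip k s (node u)
      ∂part : Vect k
      ∂part = B₊ k (∂∂• k ((1# , V) ∷ []))

proposition4p5 : ∀ {c ℓ} (k : CommutativeRing c ℓ) → IsField k → CharZero k →
    ∀ (t : Tree) →
      -- (1) χ⁻¹ P* χ (t) = 𝔑(t) = B₊(•) ∘ t
      (_≈D_ k (P* k (χ k (basis k t))) (χ k (𝔑 k t))
        × _≈V_ k (𝔑 k t) (_∘GL_ k (basis k (node (• ∷ []))) (basis k t)))
      -- (2) χ⁻¹ N* χ (t) = 𝔓(t) − B₊ ∂/∂• B₋(t)
      × _≈D_ k (N* k (χ k (basis k t)))
          (χ k (_−V_ k (𝔓 k t) (B₊ k (∂∂• k ((CommutativeRing.1# k , B₋ k t) ∷ [])))))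
proposition4p5 k _ _ t = (P*-χ k t , 𝔑≈B₊•∘GL k t) , N*-χ k t
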